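{- Let $n\ge 3$ and let $PDF_n$ be the digraph on vertex set $\{1,2,\ldots,n\}$ with arcs: $(t,t+1)$ for $2\le t\le n-1$; $(1,i)$ for every $1\le i\le n$ (so in particular a self loop at vertex $1$); and $(n,1)$. For $j\in\{2,3,\ldots,n\}$, let $Z_n^j$ be the digraph obtained from $PDF_n$ by adding a self loop at vertex $j$. Then $$\Psi_{Z_n^j}(x)=x^n-2x^{n-1}-\sum_{i=0}^{j-3}x^i\quad\text{for } j>2,\qquad \Psi_{Z_n^2}(x)=x^n-2x^{n-1}.$$
   Context: The characteristic polynomial $\Psi_X(x)$ of a digraph $X$ is $\det(xI-A)$, where $A$ is the adjacency matrix of $X$ (the $(i,j)$ entry is the number of arcs from $i$ to $j$; a self loop at $i$ contributes $1$ to the $(i,i)$ entry). -}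

module Defs where

open import Level using (Level)
open import Data.Nat using (ℕ; zero; suc; _∸_; _≤?_; _≟_)
open import Data.Fin using (Fin; zero; suc; toℕ; punchIn)
open import Data.Bool using (Bool; true; false; _∧_)
open import Relation.Nullary.Decidable using (⌊_⌋)
open import Algebra.Bundles using (CommutativeRing)

-- Vertices are Fin n; vertex v of Fin n stands for the paper's vertex (toℕ v + 1).
label : ∀ {n} → Fin n → ℕ
label v = suc (toℕ v)

-- A (multi)digraph on n vertices is given by its adjacency matrix:
-- entry (u , v) = number of arcs from u to v (a self loop at u counts 1 at (u , u)).
Digraph : ℕ → Set
Digraph n = Fin n → Fin n → ℕ

b2n : Bool → ℕ
b2n true  = 1
b2n false = 0

PDF : (n : ℕ) → Digraph n
PDF n u v =
    b2n (⌊ 2 ≤? label u ⌋ ∧ ⌊ label u ≤? n ∸ 1 ⌋ ∧ ⌊ label v ≟ suc (label u) ⌋)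
  Data.Nat.+ b2n ⌊ label u ≟ 1 ⌋
  Data.Nat.+ b2n (⌊ label u ≟ n ⌋ ∧ ⌊ label v ≟ 1 ⌋)

Z : (n : ℕ) → Fin n → Digraph n
Z n j u v = PDF n u v Data.Nat.+ b2n (⌊ label u ≟ label j ⌋ ∧ ⌊ label v ≟ label j ⌋)

module _ {c ℓ : Level} (R : CommutativeRing c ℓ) where
  open CommutativeRing R using (Carrier; _≈_; _+_; _*_; _-_; 0#; 1#)

  ℕ→R : ℕ → Carrier
  ℕ→R zero    = 0#
  ℕ→R (suc k) = 1# + ℕ→R k

  pow : Carrier → ℕ → Carrier
  pow x zero    = 1#
  pow x (suc k) = x * pow x k

  geomSum : Carrier → ℕ → Carrier
  geomSum x zero    = 0#
  geomSum x (suc m) = geomSum x m + pow x m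

  altSum : ∀ m → (Fin m → Carrier) → Carrier
  altSum zero    f = 0#
  altSum (suc m) f = f zero - altSum m (λ k → f (suc k))

  det : ∀ n → (Fin n → Fin n → Carrier) → Carrier
  det zero    M = 1#
  det (suc n) M = altSum (suc n) (λ j → M zero j * det n (λ i k → M (suc i) (punchIn j k)))

  δ : ∀ {n} → Fin n → Fin n → Carrier
  δ u v with ⌊ toℕ u ≟ toℕ v ⌋
  ... | true  = 1#
  ... | false = 0#

  charPolyAt : ∀ {n} → Digraph n → Carrier → Carrier
  charPolyAt {n} A x = det n (λ u v → δ u v * x - ℕ→R (A u v))

module Submission where

-- Write n = N + 1.  Vertex 1 has arcs to every vertex, the
-- vertices 2, …, n-1 have an arc to their successor, n has an arc back to 1,
-- and there is an extra loop at j ≥ 2.  Hence x I - A is a "fan" matrix: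
--   first row (x-1, -1, …, -1); rows 2, …, n bidiagonal with diagonal
--   e₁, …, e_N (e_t = x, except e = x - 1 at the looped vertex) and
--   superdiagonal -1; first column zero below the top except -1 in row n.
-- Expanding det along the first row (the definition of det), the minor of
-- column 1 is triangular and the minor of column k+2 is, after expanding it
-- along its first column, a bidiagonal matrix with one column deleted; this
-- gives the general identity  det = (x-1) e₁⋯e_N - Σ_{k<N} e₁⋯e_k  (D-fan).
-- With the diagonal above, the prefix products are x^k before the loop and
-- x^(k-1)(x-1) after it, and the identity evaluates to
-- x^n - 2x^(n-1) - (1 + x + ⋯ + x^(j-3))  (OneShiftedDiagonal.fan-value).

open import Defs
open import Level using (Level)
open import Data.Nat as ℕ using (ℕ; zero; suc; _≤_; _<_; _∸_; _≟_; _≤?_; z≤n; s≤s)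
open import Data.Nat.Properties using (1+n≢n; ≤-pred; n∸n≡0; n≤1+n; ≤-trans; ≤-refl; <-irrefl; m≢1+n+m; m∸n+n≡m)
open import Data.Fin using (Fin; zero; suc; toℕ; punchIn; inject₁; fromℕ)
open import Data.Fin.Properties using (toℕ<n; toℕ-inject₁; toℕ-fromℕ; toℕ-injective)
open import Data.Product using (_×_; _,_)
open import Function using (_∘_)
open import Data.Empty using (⊥-elim)
open import Data.Bool using (true; false; _∧_; if_then_else_)
open import Data.Bool.Properties using (∧-zeroʳ)
open import Relation.Nullary using (Dec; yes; no; ¬_; contradiction)
open import Relation.Nullary.Decidable using (⌊_⌋)
open import Relation.Binary.PropositionalEquality as ≡ using (_≡_; _≢_)
open import Algebra.Bundles using (CommutativeRing)

⌊⌋-yes : ∀ {a} {A : Set a} (d : Dec A) → A → ⌊ d ⌋ ≡ true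
⌊⌋-yes (yes _) _  = ≡.refl
⌊⌋-yes (no ¬a) a  = contradiction a ¬a

⌊⌋-no : ∀ {a} {A : Set a} (d : Dec A) → ¬ A → ⌊ d ⌋ ≡ false
⌊⌋-no (no _)  _  = ≡.refl
⌊⌋-no (yes a) ¬a = contradiction a ¬a

∧-no : ∀ {a b} {A : Set a} {B : Set b} (d : Dec A) (d′ : Dec B) → (A → ¬ B) → ⌊ d ⌋ ∧ ⌊ d′ ⌋ ≡ false
∧-no (yes a) (yes b) a⇒¬b = contradiction b (a⇒¬b a)
∧-no (yes _) (no _)  _    = ≡.refl
∧-no (no _)  _       _    = ≡.refl

module Determinants {c ℓ : Level} (R : CommutativeRing c ℓ) where
  open CommutativeRing R hiding (zero)
  open import Algebra.Properties.Ring ring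
    using (-0#≈0#; -1*x≈-x; -‿involutive; -‿distribˡ-*; -‿distribʳ-*; -‿+-comm; x[y-z]≈xy-xz; [y-z]x≈yx-zx)
  open import Algebra.Properties.CommutativeSemigroup *-commutativeSemigroup
    using (x∙yz≈y∙xz; xy∙z≈zx∙y)
  open import Relation.Binary.Reasoning.Setoid setoid

  x-0≈x : ∀ a → a - 0# ≈ a
  x-0≈x a = trans (+-congˡ -0#≈0#) (+-identityʳ a)

  zero-factorˡ : ∀ {a} b → a ≈ 0# → a * b ≈ 0#
  zero-factorˡ b a≈0 = trans (*-congʳ a≈0) (zeroˡ b)

  zero-factorʳ : ∀ a {b} → b ≈ 0# → a * b ≈ 0#
  zero-factorʳ a b≈0 = trans (*-congˡ b≈0) (zeroʳ a)

  minus-sum : ∀ P g a → P - (g + a) ≈ (P - a) - g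
  minus-sum P g a = begin
    P - (g + a)      ≈⟨ +-congˡ (-‿cong (+-comm g a)) ⟩
    P - (a + g)      ≈⟨ +-congˡ (sym (-‿+-comm a g)) ⟩
    P + (- a + - g)  ≈⟨ sym (+-assoc _ _ _) ⟩
    (P - a) - g      ∎

  cancel-common : ∀ a b p → (b + p) - (a + b) ≈ p - a
  cancel-common a b p = begin
    (b + p) - (a + b)  ≈⟨ +-cong (+-comm b p) (-‿cong (+-comm a b)) ⟩
    (p + b) - (b + a)  ≈⟨ minus-sum (p + b) b a ⟩
    ((p + b) - a) - b  ≈⟨ +-congʳ (+-assoc p b (- a)) ⟩
    (p + (b - a)) - b  ≈⟨ +-congʳ (+-congˡ (+-comm b (- a))) ⟩
    (p + (- a + b)) - b ≈⟨ +-congʳ (sym (+-assoc p (- a) b)) ⟩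
    ((p - a) + b) - b  ≈⟨ +-assoc _ _ _ ⟩
    (p - a) + (b - b)  ≈⟨ +-congˡ (-‿inverseʳ b) ⟩
    (p - a) + 0#       ≈⟨ +-identityʳ _ ⟩
    p - a              ∎

  -- -1 · (s · (-1 · z)) = s · z: the two entries -1 met when expanding a
  -- non-leading term of the fan determinant cancel
  cancel-minus-ones : ∀ s z → - 1# * (s * (- 1# * z)) ≈ s * z
  cancel-minus-ones s z = begin
    - 1# * (s * (- 1# * z)) ≈⟨ -1*x≈-x _ ⟩
    - (s * (- 1# * z))      ≈⟨ -‿cong (*-congˡ (-1*x≈-x z)) ⟩
    - (s * - z)             ≈⟨ -‿cong (sym (-‿distribʳ-* s z)) ⟩
    - - (s * z)             ≈⟨ -‿involutive _ ⟩
    s * z                   ∎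

  sgn : ℕ → Carrier
  sgn zero    = 1#
  sgn (suc m) = - sgn m

  sgn-square : ∀ m → sgn m * sgn m ≈ 1#
  sgn-square zero    = *-identityˡ 1#
  sgn-square (suc m) = begin
    - sgn m * - sgn m     ≈⟨ sym (-‿distribˡ-* _ _) ⟩
    - (sgn m * - sgn m)   ≈⟨ -‿cong (sym (-‿distribʳ-* _ _)) ⟩
    - - (sgn m * sgn m)   ≈⟨ -‿involutive _ ⟩
    sgn m * sgn m         ≈⟨ sgn-square m ⟩
    1#                    ∎

  sgn-split : ∀ {k m} → k ≤ m → sgn m * sgn (m ∸ k) ≈ sgn k
  sgn-split {zero}  {m}     _         = sgn-square m
  sgn-split {suc k} {suc m} (s≤s k≤m) =
    trans (sym (-‿distribˡ-* _ _)) (-‿cong (sgn-split k≤m))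

  Σ< : ℕ → (ℕ → Carrier) → Carrier
  Σ< zero    h = 0#
  Σ< (suc m) h = h 0 + Σ< m (h ∘ suc)

  prefixProd : (ℕ → Carrier) → ℕ → Carrier
  prefixProd e zero    = 1#
  prefixProd e (suc p) = e 0 * prefixProd (e ∘ suc) p

  prefixProd-snoc : ∀ e p → prefixProd e (suc p) ≈ prefixProd e p * e p
  prefixProd-snoc e zero    = *-comm _ _
  prefixProd-snoc e (suc p) = trans (*-congˡ (prefixProd-snoc (e ∘ suc) p)) (sym (*-assoc _ _ _))

  Σ<-snoc : ∀ m h → Σ< (suc m) h ≈ Σ< m h + h m
  Σ<-snoc zero    h = trans (+-identityʳ _) (sym (+-identityˡ _))
  Σ<-snoc (suc m) h = trans (+-congˡ (Σ<-snoc m (h ∘ suc))) (sym (+-assoc _ _ _))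

  AS : ∀ m → (Fin m → Carrier) → Carrier
  AS = altSum R

  D : ∀ m → (Fin m → Fin m → Carrier) → Carrier
  D = det R

  AS-cong : ∀ m {f g : Fin m → Carrier} → (∀ k → f k ≈ g k) → AS m f ≈ AS m g
  AS-cong zero    f≈g = refl
  AS-cong (suc m) f≈g = +-cong (f≈g zero) (-‿cong (AS-cong m (f≈g ∘ suc)))

  AS-zero : ∀ m {f : Fin m → Carrier} → (∀ k → f k ≈ 0#) → AS m f ≈ 0#
  AS-zero zero    f≈0 = refl
  AS-zero (suc m) f≈0 = begin
    _ - AS m _   ≈⟨ +-cong (f≈0 zero) (-‿cong (AS-zero m (f≈0 ∘ suc))) ⟩
    0# - 0#      ≈⟨ x-0≈x 0# ⟩
    0#           ∎

  AS-scale : ∀ m a (f : Fin m → Carrier) → AS m (λ k → a * f k) ≈ a * AS m f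
  AS-scale zero    a f = sym (zeroʳ a)
  AS-scale (suc m) a f = begin
    a * f zero - AS m (λ k → a * f (suc k)) ≈⟨ +-congˡ (-‿cong (AS-scale m a (f ∘ suc))) ⟩
    a * f zero - a * AS m (f ∘ suc)          ≈⟨ sym (x[y-z]≈xy-xz a _ _) ⟩
    a * AS (suc m) f                         ∎

  AS-neg : ∀ m (f : Fin m → Carrier) → AS m (λ k → - f k) ≈ - AS m f
  AS-neg zero    f = sym -0#≈0#
  AS-neg (suc m) f = begin
    - f zero - AS m (λ k → - f (suc k)) ≈⟨ +-congˡ (-‿cong (AS-neg m (f ∘ suc))) ⟩
    - f zero + - - AS m (f ∘ suc)        ≈⟨ -‿+-comm _ _ ⟩
    - AS (suc m) f                       ∎

  AS-sgn : ∀ m (h : ℕ → Carrier) → AS m (λ k → sgn (toℕ k) * h (toℕ k)) ≈ Σ< m h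
  AS-sgn zero    h = refl
  AS-sgn (suc m) h = begin
    1# * h 0 - AS m (λ k → - sgn (toℕ k) * h (suc (toℕ k)))
      ≈⟨ +-cong (*-identityˡ _) (-‿cong (AS-cong m (λ k → sym (-‿distribˡ-* _ _)))) ⟩
    h 0 - AS m (λ k → - (sgn (toℕ k) * h (suc (toℕ k))))
      ≈⟨ +-congˡ (-‿cong (AS-neg m _)) ⟩
    h 0 - - AS m (λ k → sgn (toℕ k) * h (suc (toℕ k)))
      ≈⟨ +-congˡ (-‿involutive _) ⟩
    h 0 + AS m (λ k → sgn (toℕ k) * h (suc (toℕ k)))
      ≈⟨ +-congˡ (AS-sgn m (h ∘ suc)) ⟩
    Σ< (suc m) h ∎

  minor : ∀ {n} → (Fin (suc n) → Fin (suc n) → Carrier) → Fin (suc n) → Fin n → Fin n → Carrier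
  minor M j i k = M (suc i) (punchIn j k)

  term : ∀ {n} → (Fin (suc n) → Fin (suc n) → Carrier) → Fin (suc n) → Carrier
  term {n} M j = M zero j * D n (minor M j)

  D-head : ∀ n (M : Fin (suc n) → Fin (suc n) → Carrier) → (∀ k → term M (suc k) ≈ 0#) →
           D (suc n) M ≈ M zero zero * D n (λ i k → M (suc i) (suc k))
  D-head n M tail≈0 = trans (+-congˡ (-‿cong (AS-zero n tail≈0))) (x-0≈x _)

  D-zero-column : ∀ n (M : Fin (suc n) → Fin (suc n) → Carrier) → (∀ i → M i zero ≈ 0#) →
                  D (suc n) M ≈ 0#
  D-zero-column n M col≈0 = AS-zero (suc n) (term≈0 n M col≈0)
    where
    term≈0 : ∀ n (M : Fin (suc n) → Fin (suc n) → Carrier) → (∀ i → M i zero ≈ 0#) →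
             ∀ j → term M j ≈ 0#
    term≈0 n       M col≈0 zero    = zero-factorˡ _ (col≈0 zero)
    term≈0 (suc n) M col≈0 (suc k) = zero-factorʳ _ (D-zero-column n (minor M (suc k)) (col≈0 ∘ suc))

  D-first-column : ∀ n (M : Fin (suc n) → Fin (suc n) → Carrier) → (∀ i → M (suc i) zero ≈ 0#) →
                   D (suc n) M ≈ M zero zero * D n (λ i k → M (suc i) (suc k))
  D-first-column zero    M _     = D-head zero M (λ ())
  D-first-column (suc n) M col≈0 =
    D-head (suc n) M (λ k → zero-factorʳ _ (D-zero-column n (minor M (suc k)) col≈0))

  D-first-row : ∀ n (M : Fin (suc n) → Fin (suc n) → Carrier) → (∀ k → M zero (suc k) ≈ 0#) →
                D (suc n) M ≈ M zero zero * D n (λ i k → M (suc i) (suc k))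
  D-first-row n M row≈0 = D-head n M (λ k → zero-factorˡ _ (row≈0 k))

  D-bottom-left : ∀ m (M : Fin (suc m) → Fin (suc m) → Carrier) → (∀ i → M (inject₁ i) zero ≈ 0#) →
                  D (suc m) M ≈ sgn m * (M (fromℕ m) zero * D m (λ i k → M (inject₁ i) (suc k)))
  D-bottom-left zero    M _     = trans (x-0≈x _) (sym (*-identityˡ _))
  D-bottom-left (suc m) M col≈0 = begin
    term M zero - AS (suc m) (λ k → term M (suc k))
      ≈⟨ +-cong (zero-factorˡ _ (col≈0 zero)) (-‿cong (AS-cong (suc m) expand-minor)) ⟩
    0# - AS (suc m) (λ k → X k * (s * (b * Y k)))
      ≈⟨ +-identityˡ _ ⟩
    - AS (suc m) (λ k → X k * (s * (b * Y k)))
      ≈⟨ -‿cong (AS-cong (suc m) (λ k → rearrange (X k) (Y k))) ⟩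
    - AS (suc m) (λ k → (s * b) * (X k * Y k))
      ≈⟨ -‿cong (AS-scale (suc m) (s * b) (λ k → X k * Y k)) ⟩
    - ((s * b) * AS (suc m) (λ k → X k * Y k))
      ≈⟨ -‿cong (*-assoc s b _) ⟩
    - (s * (b * AS (suc m) (λ k → X k * Y k)))
      ≈⟨ -‿distribˡ-* s _ ⟩
    sgn (suc m) * (b * D (suc m) (λ i k → M (inject₁ i) (suc k))) ∎
    where
    s = sgn m
    b = M (fromℕ (suc m)) zero
    X : Fin (suc m) → Carrier
    X k = M zero (suc k)
    Y : Fin (suc m) → Carrier
    Y k = D m (λ i l → M (suc (inject₁ i)) (suc (punchIn k l)))
    expand-minor : ∀ k → term M (suc k) ≈ X k * (s * (b * Y k))
    expand-minor k = *-congˡ (D-bottom-left m (minor M (suc k)) (col≈0 ∘ suc))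
    rearrange : ∀ x y → x * (s * (b * y)) ≈ (s * b) * (x * y)
    rearrange x y = begin
      x * (s * (b * y)) ≈⟨ x∙yz≈y∙xz x s _ ⟩
      s * (x * (b * y)) ≈⟨ *-congˡ (x∙yz≈y∙xz x b y) ⟩
      s * (b * (x * y)) ≈⟨ sym (*-assoc s b _) ⟩
      (s * b) * (x * y) ∎

  bidiag : (ℕ → Carrier) → ℕ → ℕ → Carrier
  bidiag e zero    zero          = e 0
  bidiag e zero    (suc zero)    = - 1#
  bidiag e zero    (suc (suc b)) = 0#
  bidiag e (suc a) zero          = 0#
  bidiag e (suc a) (suc b)       = bidiag (e ∘ suc) a b

  bidiag-diagonal : ∀ e a → bidiag e a a ≡ e a
  bidiag-diagonal e zero    = ≡.refl
  bidiag-diagonal e (suc a) = bidiag-diagonal (e ∘ suc) a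

  bidiag-super : ∀ e a → bidiag e a (suc a) ≡ - 1#
  bidiag-super e zero    = ≡.refl
  bidiag-super e (suc a) = bidiag-super (e ∘ suc) a

  bidiag-off : ∀ e {a b} → b ≢ a → b ≢ suc a → bidiag e a b ≡ 0#
  bidiag-off e {zero}  {zero}        b≢a _     = ⊥-elim (b≢a ≡.refl)
  bidiag-off e {zero}  {suc zero}    _   b≢1+a = ⊥-elim (b≢1+a ≡.refl)
  bidiag-off e {zero}  {suc (suc b)} _   _     = ≡.refl
  bidiag-off e {suc a} {zero}        _   _     = ≡.refl
  bidiag-off e {suc a} {suc b}       b≢a b≢1+a =
    bidiag-off (e ∘ suc) (b≢a ∘ ≡.cong suc) (b≢1+a ∘ ≡.cong suc)

  pin : ℕ → ℕ → ℕ
  pin zero    b       = suc b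
  pin (suc p) zero    = zero
  pin (suc p) (suc b) = suc (pin p b)

  -- the matrices below are indexed by ℕ, so punchIn is transported to pin
  toℕ-punchIn : ∀ {m} (p : Fin (suc m)) (l : Fin m) → toℕ (punchIn p l) ≡ pin (toℕ p) (toℕ l)
  toℕ-punchIn zero    l       = ≡.refl
  toℕ-punchIn (suc p) zero    = ≡.refl
  toℕ-punchIn (suc p) (suc l) = ≡.cong suc (toℕ-punchIn p l)

  pin-below : ∀ {p b} → b < p → pin p b ≡ b
  pin-below {suc p} {zero}  _         = ≡.refl
  pin-below {suc p} {suc b} (s≤s b<p) = ≡.cong suc (pin-below b<p)

  -- Deleting column p from the m × (m+1) upper bidiagonal matrix leaves
  -- an upper triangular block (columns < p) and a lower triangular block
  -- with -1 on its diagonal, so the determinant is (-1)^(m-p) e 0 ⋯ e (p-1).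
  D-bidiag-gap : ∀ p m e (M : Fin m → Fin m → Carrier) → p ≤ m →
                 (∀ i l → M i l ≈ bidiag e (toℕ i) (pin p (toℕ l))) →
                 D m M ≈ sgn (m ∸ p) * prefixProd e p
  D-bidiag-gap zero    zero    e M _ _ = sym (*-identityˡ 1#)
  D-bidiag-gap zero    (suc m) e M _ M≈ = begin
    D (suc m) M                                  ≈⟨ D-first-row m M (λ k → M≈ zero (suc k)) ⟩
    M zero zero * D m (λ i k → M (suc i) (suc k)) ≈⟨ *-cong (M≈ zero zero) (D-bidiag-gap zero m (e ∘ suc) _ z≤n (λ i l → M≈ (suc i) (suc l))) ⟩
    - 1# * (sgn m * 1#)                          ≈⟨ -1*x≈-x _ ⟩
    - (sgn m * 1#)                               ≈⟨ -‿distribˡ-* _ _ ⟩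
    sgn (suc m) * 1#                             ∎
  D-bidiag-gap (suc p) (suc m) e M (s≤s p≤m) M≈ = begin
    D (suc m) M                                  ≈⟨ D-first-column m M (λ i → M≈ (suc i) zero) ⟩
    M zero zero * D m (λ i k → M (suc i) (suc k)) ≈⟨ *-cong (M≈ zero zero) (D-bidiag-gap p m (e ∘ suc) _ p≤m (λ i l → M≈ (suc i) (suc l))) ⟩
    e 0 * (sgn (m ∸ p) * prefixProd (e ∘ suc) p) ≈⟨ x∙yz≈y∙xz _ _ _ ⟩
    sgn (m ∸ p) * prefixProd e (suc p)            ∎

  -- Expanding along the first row: the minor of column 0 is triangular, the
  -- minor of column k+1 is, after expanding along its first column, a
  -- bidiagonal matrix with column k deleted.
  D-fan : ∀ m c e (M : Fin (suc (suc m)) → Fin (suc (suc m)) → Carrier) →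
          M zero zero ≈ c →
          (∀ k → M zero (suc k) ≈ - 1#) →
          (∀ a b → M (suc a) (suc b) ≈ bidiag e (toℕ a) (toℕ b)) →
          M (suc (fromℕ m)) zero ≈ - 1# →
          (∀ i → M (suc (inject₁ i)) zero ≈ 0#) →
          D (suc (suc m)) M ≈ c * prefixProd e (suc m) - Σ< (suc m) (prefixProd e)
  D-fan m c e M top-left top inner corner left =
    +-cong first-term (-‿cong (trans (AS-cong (suc m) other-term) (AS-sgn (suc m) (prefixProd e))))
    where
    first-term : term M zero ≈ c * prefixProd e (suc m)
    first-term = *-cong top-left (begin
      D (suc m) (minor M zero)                           ≈⟨ D-bidiag-gap (suc m) (suc m) e _ ≤-refl triangular ⟩
      sgn (m ∸ m) * prefixProd e (suc m)                 ≈⟨ *-congʳ (reflexive (≡.cong sgn (n∸n≡0 m))) ⟩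
      1# * prefixProd e (suc m)                          ≈⟨ *-identityˡ _ ⟩
      prefixProd e (suc m)                               ∎)
      where
      triangular : ∀ i l → minor M zero i l ≈ bidiag e (toℕ i) (pin (suc m) (toℕ l))
      triangular i l = trans (inner i l) (reflexive (≡.cong (bidiag e (toℕ i)) (≡.sym (pin-below (toℕ<n l)))))

    other-term : ∀ k → term M (suc k) ≈ sgn (toℕ k) * prefixProd e (toℕ k)
    other-term k = begin
      M zero (suc k) * D (suc m) (minor M (suc k))
        ≈⟨ *-cong (top k) (D-bottom-left m (minor M (suc k)) left) ⟩
      - 1# * (sgn m * (M (suc (fromℕ m)) zero * D m gapped))
        ≈⟨ *-congˡ (*-congˡ (*-cong corner (D-bidiag-gap (toℕ k) m e gapped (≤-pred (toℕ<n k)) gapped≈))) ⟩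
      - 1# * (sgn m * (- 1# * (sgn (m ∸ toℕ k) * prefixProd e (toℕ k))))
        ≈⟨ cancel-minus-ones _ _ ⟩
      sgn m * (sgn (m ∸ toℕ k) * prefixProd e (toℕ k))
        ≈⟨ sym (*-assoc _ _ _) ⟩
      (sgn m * sgn (m ∸ toℕ k)) * prefixProd e (toℕ k)
        ≈⟨ *-congʳ (sgn-split (≤-pred (toℕ<n k))) ⟩
      sgn (toℕ k) * prefixProd e (toℕ k) ∎
      where
      gapped : Fin m → Fin m → Carrier
      gapped i l = M (suc (inject₁ i)) (suc (punchIn k l))
      gapped≈ : ∀ i l → gapped i l ≈ bidiag e (toℕ i) (pin (toℕ k) (toℕ l))
      gapped≈ i l = trans (inner (inject₁ i) (punchIn k l))
        (reflexive (≡.cong₂ (bidiag e) (toℕ-inject₁ i) (toℕ-punchIn k l)))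

  -- The prefix products are x^t up to t = q and x^(t-1)(x-1) afterwards,
  -- and the prefix sums telescope to (1 + ⋯ + x^(q-1)) + x^(t-1) after q.
  module OneShiftedDiagonal (x : Carrier) (q : ℕ) (e : ℕ → Carrier)
           (e-off : ∀ t → t ≢ q → e t ≈ x) (e-at : e q ≈ x - 1#) where

    xⁿ : ℕ → Carrier
    xⁿ = pow R x

    geom : ℕ → Carrier
    geom = geomSum R x

    absorb : ∀ a → a + a * (x - 1#) ≈ x * a
    absorb a = begin
      a + a * (x - 1#)      ≈⟨ +-congʳ (sym (*-identityʳ a)) ⟩
      a * 1# + a * (x - 1#) ≈⟨ sym (distribˡ a 1# _) ⟩
      a * (1# + (x - 1#))   ≈⟨ *-congˡ one-plus ⟩
      a * x                 ≈⟨ *-comm a x ⟩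
      x * a                 ∎
      where
      one-plus : 1# + (x - 1#) ≈ x
      one-plus = begin
        1# + (x - 1#)   ≈⟨ +-comm _ _ ⟩
        (x - 1#) + 1#   ≈⟨ +-assoc _ _ _ ⟩
        x + (- 1# + 1#) ≈⟨ +-congˡ (-‿inverseˡ 1#) ⟩
        x + 0#          ≈⟨ +-identityʳ x ⟩
        x               ∎

    prefix-below : ∀ t → t ≤ q → prefixProd e t ≈ xⁿ t
    prefix-below zero    _   = refl
    prefix-below (suc t) t<q = begin
      prefixProd e (suc t) ≈⟨ prefixProd-snoc e t ⟩
      prefixProd e t * e t ≈⟨ *-cong (prefix-below t (≤-trans (n≤1+n t) t<q)) (e-off t (λ t≡q → <-irrefl t≡q t<q)) ⟩
      xⁿ t * x             ≈⟨ *-comm _ _ ⟩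
      xⁿ (suc t)           ∎

    sum-below : ∀ t → t ≤ q → Σ< t (prefixProd e) ≈ geom t
    sum-below zero    _   = refl
    sum-below (suc t) t<q = trans (Σ<-snoc t (prefixProd e)) (+-cong (sum-below t t≤q) (prefix-below t t≤q))
      where t≤q = ≤-trans (n≤1+n t) t<q

    prefix-above : ∀ r → prefixProd e (suc (r ℕ.+ q)) ≈ xⁿ (r ℕ.+ q) * (x - 1#)
    prefix-above zero    = trans (prefixProd-snoc e q) (*-cong (prefix-below q ≤-refl) e-at)
    prefix-above (suc r) = begin
      prefixProd e (suc (suc (r ℕ.+ q)))           ≈⟨ prefixProd-snoc e (suc (r ℕ.+ q)) ⟩
      prefixProd e (suc (r ℕ.+ q)) * e (suc (r ℕ.+ q)) ≈⟨ *-cong (prefix-above r) (e-off _ (λ eq → m≢1+n+m q (≡.sym eq))) ⟩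
      (xⁿ (r ℕ.+ q) * (x - 1#)) * x                 ≈⟨ xy∙z≈zx∙y _ _ _ ⟩
      xⁿ (suc (r ℕ.+ q)) * (x - 1#)                 ∎

    sum-above : ∀ r → Σ< (suc (r ℕ.+ q)) (prefixProd e) ≈ geom q + xⁿ (r ℕ.+ q)
    sum-above zero    = trans (Σ<-snoc q (prefixProd e)) (+-cong (sum-below q ≤-refl) (prefix-below q ≤-refl))
    sum-above (suc r) = begin
      Σ< (suc (suc (r ℕ.+ q))) (prefixProd e)                     ≈⟨ Σ<-snoc (suc (r ℕ.+ q)) (prefixProd e) ⟩
      Σ< (suc (r ℕ.+ q)) (prefixProd e) + prefixProd e (suc (r ℕ.+ q)) ≈⟨ +-cong (sum-above r) (prefix-above r) ⟩
      (geom q + a) + a * (x - 1#)                               ≈⟨ +-assoc _ _ _ ⟩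
      geom q + (a + a * (x - 1#))                               ≈⟨ +-congˡ (absorb a) ⟩
      geom q + xⁿ (suc (r ℕ.+ q))                                 ∎
      where a = xⁿ (r ℕ.+ q)

    FanValue : ℕ → Set ℓ
    FanValue t = (x - 1#) * prefixProd e (suc t) - Σ< (suc t) (prefixProd e)
                   ≈ (xⁿ (suc (suc t)) - ℕ→R R 2 * xⁿ (suc t)) - geom q

    fan-value-above : ∀ r → FanValue (r ℕ.+ q)
    fan-value-above r = begin
      y * prefixProd e (suc (r ℕ.+ q)) - Σ< (suc (r ℕ.+ q)) (prefixProd e)
        ≈⟨ +-cong (*-congˡ (prefix-above r)) (-‿cong (sum-above r)) ⟩
      y * (a * y) - (geom q + a)     ≈⟨ minus-sum _ _ _ ⟩
      (y * (a * y) - a) - geom q     ≈⟨ +-congʳ core ⟩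
      (x * w - ℕ→R R 2 * w) - geom q ∎
      where
      y = x - 1#
      a = xⁿ (r ℕ.+ q)
      w = x * a
      two-times : ℕ→R R 2 * w ≈ w + w
      two-times = begin
        (1# + (1# + 0#)) * w ≈⟨ *-congʳ (+-congˡ (+-identityʳ 1#)) ⟩
        (1# + 1#) * w        ≈⟨ distribʳ w 1# 1# ⟩
        1# * w + 1# * w      ≈⟨ +-cong (*-identityˡ w) (*-identityˡ w) ⟩
        w + w                ∎
      core : y * (a * y) - a ≈ x * w - ℕ→R R 2 * w
      core = begin
        y * (a * y) - a               ≈⟨ +-congʳ (*-comm y _) ⟩
        (a * y) * y - a               ≈⟨ sym (cancel-common a (a * y) _) ⟩
        (a * y + (a * y) * y) - (a + a * y) ≈⟨ +-congʳ (sym (distribʳ y a (a * y))) ⟩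
        (a + a * y) * y - (a + a * y) ≈⟨ +-cong (*-congʳ (absorb a)) (-‿cong (absorb a)) ⟩
        w * y - w                     ≈⟨ +-congʳ (*-comm w y) ⟩
        y * w - w                     ≈⟨ +-congʳ ([y-z]x≈yx-zx w x 1#) ⟩
        (x * w - 1# * w) - w          ≈⟨ +-congʳ (+-congˡ (-‿cong (*-identityˡ w))) ⟩
        (x * w - w) - w               ≈⟨ sym (minus-sum _ w w) ⟩
        x * w - (w + w)               ≈⟨ +-congˡ (-‿cong (sym two-times)) ⟩
        x * w - ℕ→R R 2 * w           ∎

    fan-value : ∀ t → q ≤ t → FanValue t
    fan-value t q≤t = ≡.subst FanValue (m∸n+n≡m q≤t) (fan-value-above (t ∸ q))

-- The matrix x I - A of Z_n^j, n = K + 3, with the looped vertex j = J + 2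
-- (paper numbering), read off entry by entry from the definition of Z.
module CharacteristicMatrix {c ℓ : Level} (R : CommutativeRing c ℓ) (K : ℕ) (J : Fin (suc (suc K)))
         (x : CommutativeRing.Carrier R) where
  open CommutativeRing R hiding (zero)
  open Determinants R
    using (D; bidiag; bidiag-diagonal; bidiag-super; bidiag-off; x-0≈x; D-fan; module OneShiftedDiagonal)

  n : ℕ
  n = suc (suc (suc K))

  M : Fin n → Fin n → Carrier
  M u v = δ R u v * x - ℕ→R R (Z n (suc J) u v)

  e : ℕ → Carrier
  e t = if ⌊ t ≟ toℕ J ⌋ then x - 1# else x

  label-≡ : ∀ {a b} → a ≡ b → suc (suc a) ≡ suc (suc b)
  label-≡ = ≡.cong (2 ℕ.+_)

  label-≢ : ∀ {a b} → a ≢ b → suc (suc a) ≢ suc (suc b)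
  label-≢ a≢b = a≢b ∘ ≡.cong (_∸ 2)

  arcs-loop : ∀ a → toℕ a ≡ toℕ J → Z n (suc J) (suc a) (suc a) ≡ 1
  arcs-loop a a≡J
    rewrite ⌊⌋-no (label (suc a) ≟ suc (label (suc a))) (1+n≢n ∘ ≡.sym)
          | ∧-zeroʳ ⌊ label (suc a) ≤? n ∸ 1 ⌋
          | ∧-zeroʳ ⌊ label (suc a) ≟ n ⌋
          | ⌊⌋-yes (label (suc a) ≟ label (suc J)) (label-≡ a≡J) = ≡.refl

  arcs-no-loop : ∀ a → toℕ a ≢ toℕ J → Z n (suc J) (suc a) (suc a) ≡ 0
  arcs-no-loop a a≢J
    rewrite ⌊⌋-no (label (suc a) ≟ suc (label (suc a))) (1+n≢n ∘ ≡.sym)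
          | ∧-zeroʳ ⌊ label (suc a) ≤? n ∸ 1 ⌋
          | ∧-zeroʳ ⌊ label (suc a) ≟ n ⌋
          | ⌊⌋-no (label (suc a) ≟ label (suc J)) (label-≢ a≢J) = ≡.refl

  arcs-next : ∀ a b → toℕ b ≡ suc (toℕ a) → Z n (suc J) (suc a) (suc b) ≡ 1
  arcs-next a b b≡1+a
    rewrite ⌊⌋-yes (label (suc a) ≤? n ∸ 1) (≡.subst (_≤ n ∸ 1) (≡.cong suc b≡1+a) (toℕ<n b))
          | ⌊⌋-yes (label (suc b) ≟ suc (label (suc a))) (label-≡ b≡1+a)
          | ∧-zeroʳ ⌊ label (suc a) ≟ n ⌋
          | ∧-no (label (suc a) ≟ label (suc J)) (label (suc b) ≟ label (suc J))
                 (λ a≡J b≡J → 1+n≢n (≡.trans (≡.sym b≡1+a) (≡.cong (_∸ 2) (≡.trans b≡J (≡.sym a≡J))))) = ≡.refl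

  arcs-none : ∀ a b → toℕ b ≢ toℕ a → toℕ b ≢ suc (toℕ a) → Z n (suc J) (suc a) (suc b) ≡ 0
  arcs-none a b b≢a b≢1+a
    rewrite ⌊⌋-no (label (suc b) ≟ suc (label (suc a))) (label-≢ b≢1+a)
          | ∧-zeroʳ ⌊ label (suc a) ≤? n ∸ 1 ⌋
          | ∧-zeroʳ ⌊ label (suc a) ≟ n ⌋
          | ∧-no (label (suc a) ≟ label (suc J)) (label (suc b) ≟ label (suc J))
                 (λ a≡J b≡J → b≢a (≡.cong (_∸ 2) (≡.trans b≡J (≡.sym a≡J)))) = ≡.refl

  arcs-back : ∀ a → toℕ a ≡ suc K → Z n (suc J) (suc a) zero ≡ 1
  arcs-back a a≡1+K
    rewrite ∧-zeroʳ ⌊ label (suc a) ≤? n ∸ 1 ⌋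
          | ⌊⌋-yes (label (suc a) ≟ n) (label-≡ a≡1+K)
          | ∧-zeroʳ ⌊ label (suc a) ≟ label (suc J) ⌋ = ≡.refl

  arcs-no-back : ∀ a → toℕ a ≢ suc K → Z n (suc J) (suc a) zero ≡ 0
  arcs-no-back a a≢1+K
    rewrite ∧-zeroʳ ⌊ label (suc a) ≤? n ∸ 1 ⌋
          | ⌊⌋-no (label (suc a) ≟ n) (label-≢ a≢1+K)
          | ∧-zeroʳ ⌊ label (suc a) ≟ label (suc J) ⌋ = ≡.refl

  δ-same : ∀ {m} (u : Fin m) → δ R u u ≡ 1#
  δ-same u rewrite ⌊⌋-yes (toℕ u ≟ toℕ u) ≡.refl = ≡.refl

  δ-distinct : ∀ {m} {u v : Fin m} → toℕ u ≢ toℕ v → δ R u v ≡ 0#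
  δ-distinct {u = u} {v} u≢v rewrite ⌊⌋-no (toℕ u ≟ toℕ v) u≢v = ≡.refl

  entry : ∀ u v {i k} → δ R u v ≡ i → Z n (suc J) u v ≡ k → M u v ≈ i * x - ℕ→R R k
  entry u v δ≡i Z≡k = reflexive (≡.cong₂ (λ i k → i * x - ℕ→R R k) δ≡i Z≡k)

  ¬arc : 0# * x - 0# ≈ 0#
  ¬arc = trans (x-0≈x _) (zeroˡ x)

  arc : 0# * x - (1# + 0#) ≈ - 1#
  arc = trans (+-cong (zeroˡ x) (-‿cong (+-identityʳ 1#))) (+-identityˡ _)

  -- vertex 1 has an arc to every vertex, including itself
  top-left : M zero zero ≈ x - 1#
  top-left = trans (+-congʳ (*-identityˡ x)) (+-congˡ (-‿cong (+-identityʳ 1#)))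

  top : ∀ k → M zero (suc k) ≈ - 1#
  top k = arc

  diagonal : ∀ a → M (suc a) (suc a) ≈ e (toℕ a)
  diagonal a with toℕ a ≟ toℕ J
  ... | yes a≡J = trans (entry (suc a) (suc a) (δ-same (suc a)) (arcs-loop a a≡J)) top-left
  ... | no  a≢J = trans (entry (suc a) (suc a) (δ-same (suc a)) (arcs-no-loop a a≢J)) (trans (x-0≈x _) (*-identityˡ x))

  inner : ∀ a b → M (suc a) (suc b) ≈ bidiag e (toℕ a) (toℕ b)
  inner a b with toℕ b ≟ toℕ a | toℕ b ≟ suc (toℕ a)
  ... | yes b≡a | _ rewrite toℕ-injective b≡a =
    trans (diagonal a) (reflexive (≡.sym (bidiag-diagonal e (toℕ a))))
  ... | no b≢a | yes b≡1+a =
    trans (entry (suc a) (suc b) (δ-distinct {u = suc a} {suc b} (b≢a ∘ ≡.sym ∘ ≡.cong ℕ.pred)) (arcs-next a b b≡1+a))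
          (trans arc (reflexive (≡.sym (≡.trans (≡.cong (bidiag e (toℕ a)) b≡1+a) (bidiag-super e (toℕ a))))))
  ... | no b≢a | no b≢1+a =
    trans (entry (suc a) (suc b) (δ-distinct {u = suc a} {suc b} (b≢a ∘ ≡.sym ∘ ≡.cong ℕ.pred)) (arcs-none a b b≢a b≢1+a))
          (trans ¬arc (reflexive (≡.sym (bidiag-off e b≢a b≢1+a))))

  corner : M (suc (fromℕ (suc K))) zero ≈ - 1#
  corner = trans (entry (suc (fromℕ (suc K))) zero ≡.refl (arcs-back _ (toℕ-fromℕ (suc K)))) arc

  left : ∀ i → M (suc (inject₁ i)) zero ≈ 0#
  left i = trans (entry (suc (inject₁ i)) zero ≡.refl (arcs-no-back _ i≢1+K)) ¬arc
    where
    i≢1+K : toℕ (inject₁ i) ≢ suc K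
    i≢1+K eq = <-irrefl (≡.trans (≡.sym (toℕ-inject₁ i)) eq) (toℕ<n i)

  e-off : ∀ t → t ≢ toℕ J → e t ≈ x
  e-off t t≢J rewrite ⌊⌋-no (t ≟ toℕ J) t≢J = refl

  e-at : e (toℕ J) ≈ x - 1#
  e-at rewrite ⌊⌋-yes (toℕ J ≟ toℕ J) ≡.refl = refl

  open OneShiftedDiagonal x (toℕ J) e e-off e-at using (fan-value)

  char-poly : D n M ≈ (pow R x n - ℕ→R R 2 * pow R x (suc (suc K))) - geomSum R x (toℕ J)
  char-poly = trans (D-fan (suc K) (x - 1#) e M top-left top inner corner left)
                    (fan-value (suc K) (≤-pred (toℕ<n J)))

-- For j = 2 the geometric sum is empty, so both cases are char-poly.
mainTheorem2 : ∀ {c ℓ : Level} (R : CommutativeRing c ℓ) (n : ℕ) → 3 ≤ n → (j : Fin n) → 2 ≤ label j →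
    (x : CommutativeRing.Carrier R) →
      (2 < label j →
        CommutativeRing._≈_ R (charPolyAt R (Z n j) x)
          (CommutativeRing._-_ R
            (CommutativeRing._-_ R (pow R x n)
              (CommutativeRing._*_ R (ℕ→R R 2) (pow R x (n ∸ 1))))
            (geomSum R x (label j ∸ 2))))
      × (label j ≡ 2 →
        CommutativeRing._≈_ R (charPolyAt R (Z n j) x)
          (CommutativeRing._-_ R (pow R x n)
            (CommutativeRing._*_ R (ℕ→R R 2) (pow R x (n ∸ 1)))))
mainTheorem2 R (suc (suc (suc K))) (s≤s (s≤s (s≤s _))) zero    (s≤s ()) x
mainTheorem2 R (suc (suc (suc K))) (s≤s (s≤s (s≤s _))) (suc J) _        x =
  (λ _ → char-poly) , (λ label≡2 → trans char-poly (empty-geometric-sum (≡.cong (_∸ 2) label≡2)))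
  where
  open CommutativeRing R using (_≈_; _-_; trans)
  open CharacteristicMatrix R K J x using (char-poly)
  open Determinants R using (x-0≈x)
  empty-geometric-sum : ∀ {a} → toℕ J ≡ 0 → a - geomSum R x (toℕ J) ≈ a
  empty-geometric-sum {a} J≡0 rewrite J≡0 = x-0≈x a
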